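{- For every integer $n\geq 6$ with $n\equiv 2\pmod 4$, there exists a Heffter array $H(n;5)$.
   Context: A Heffter array $H(n;k)$ is an $n\times n$ array, some of whose cells are filled with integers, such that: each row and each column contains exactly $k$ filled cells; every row sum and column sum is congruent to $0$ modulo $2nk+1$; and for each integer $1\leq x\leq nk$, either $x$ or $-x$ appears in the array. -}

module Defs where

open import Data.Nat using (ℕ; suc; _+_; _*_)
open import Data.Integer using (ℤ; +_; -_)
open import Data.Integer.Divisibility using (_∣_)
open import Data.Fin using (Fin)
open import Data.Maybe using (Maybe; just; nothing)
open import Data.Product using (Σ; ∃; _×_; _,_)
open import Data.Sum using (_⊎_)
open import Relation.Binary.PropositionalEquality using (_≡_)

-- A partially filled n × n array of integers: `nothing` = empty cell.
PartialArray : ℕ → Set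
PartialArray n = Fin n → Fin n → Maybe ℤ

filledCount : ∀ {n} → (Fin n → Maybe ℤ) → ℕ
filledCount {ℕ.zero} f = 0
filledCount {suc n} f with f Fin.zero
... | just _  = suc (filledCount (λ i → f (Fin.suc i)))
... | nothing = filledCount (λ i → f (Fin.suc i))

lineSum : ∀ {n} → (Fin n → Maybe ℤ) → ℤ
lineSum {ℕ.zero} f = + 0
lineSum {suc n} f with f Fin.zero
... | just v  = v Data.Integer.+ lineSum (λ i → f (Fin.suc i))
... | nothing = lineSum (λ i → f (Fin.suc i))

row : ∀ {n} → PartialArray n → Fin n → Fin n → Maybe ℤ
row A i = λ j → A i j

col : ∀ {n} → PartialArray n → Fin n → Fin n → Maybe ℤ
col A j = λ i → A i j

record IsHeffter (n k : ℕ) (A : PartialArray n) : Set where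
  field
    rowFilled : ∀ i → filledCount (row A i) ≡ k
    colFilled : ∀ j → filledCount (col A j) ≡ k
    rowSum    : ∀ i → (+ (2 * n * k + 1)) ∣ lineSum (row A i)
    colSum    : ∀ j → (+ (2 * n * k + 1)) ∣ lineSum (col A j)
    covers    : ∀ (x : ℕ) → 1 Data.Nat.≤ x → x Data.Nat.≤ n * k →
                Σ (Fin n) λ i → Σ (Fin n) λ j →
                  (A i j ≡ just (+ x)) ⊎ (A i j ≡ just (- (+ x)))

HeffterArrayExists : ℕ → ℕ → Set
HeffterArrayExists n k = Σ (PartialArray n) λ A → IsHeffter n k A

-- Write n = h + h with h ≥ 3; the construction works for every even n ≥ 6.  Rows and columns
-- are split into two halves of size h, and the array is filled along five "diagonals" (f , k),
-- (f , k) ∈ {(0,0), (0,1), (0,2), (1,1), (1,2)}: the diagonal (f , k) has an entry in row q of a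
-- half and column q + k (mod h) of the same half (f = 0) or of the other one (f = 1).  Every row
-- and every column meets each diagonal exactly once, so it has exactly 5 filled cells.  The
-- entries are affine in the row or column index, with slopes chosen so that the rows and columns
-- of the first half sum to exactly 20h + 1 = 2·n·5 + 1 and those of the second half to 0, while
-- each band {th + 1, …, (t + 1)h}, t < 10, of absolute values is swept out by one diagonal inside
-- one half (the bands t = 1, 2 jointly by the main diagonals of both halves, through the even
-- and the odd offsets).
module Submission where

open import Defs
open import Algebra.Bundles using (CommutativeMonoid)
open import Data.Bool as Bool using (Bool; true; false; if_then_else_; T; _xor_)
open import Data.Bool.Properties using (not-injective; xor-assoc; xor-same; xor-identityʳ)
open import Data.Fin as Fin using (Fin; zero; suc; toℕ; fromℕ<)
open import Data.Fin.Patterns using (0F; 1F; 2F; 3F; 4F; 5F; 6F; 7F; 8F; 9F)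
open import Data.Fin.Properties using (toℕ<n; toℕ-fromℕ<)
open import Data.Integer as ℤ using (ℤ; +_; -_)
import Data.Integer.Properties as ℤ
open import Data.Integer.Divisibility using (_∣_)
open import Data.Integer.Tactic.RingSolver using (solve-∀)
open import Data.List using (List; []; _∷_; map; foldr; length)
open import Data.List.Properties using (map-∘)
open import Data.List.Membership.Propositional using (_∈_)
open import Data.List.Membership.Propositional.Properties using (∈-map⁺)
open import Data.List.Relation.Unary.All as All using (All; []; _∷_; universal)
import Data.List.Relation.Unary.All.Properties as All
open import Data.List.Relation.Unary.Any using (here; there)
open import Data.List.Relation.Unary.Unique.Propositional using (Unique; []; _∷_)
import Data.List.Relation.Unary.Unique.Propositional.Properties as Unique
open import Data.Maybe using (Maybe; just; nothing; fromMaybe)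
open import Data.Nat as ℕ
  using (ℕ; zero; suc; pred; _+_; _*_; _∸_; _<_; _≤_; _%_; _/_; _≡ᵇ_; _<?_; s≤s; z≤n; >-nonZero)
import Data.Nat.Properties as ℕ
import Data.Nat.DivMod as ℕ
import Data.Nat.Divisibility as ℕ
import Data.Nat.Tactic.RingSolver as ℕ
open import Data.Product using (Σ; ∃; _×_; _,_; proj₁; proj₂)
open import Data.Product.Properties using (≡-dec)
open import Data.Sum as Sum using (_⊎_; inj₁; inj₂)
open import Function using (_∘_)
open import Level using (0ℓ)
open import Relation.Binary.PropositionalEquality
open import Relation.Nullary using (Dec; yes; no; contradiction)
open import Relation.Nullary.Decidable using (from-yes)

-- Lines with finitely many filled cells

Entries : Set
Entries = List (ℕ × ℤ)

keys : Entries → List ℕ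
keys = map proj₁

valueAt : ℕ → Entries → Maybe ℤ
valueAt c []            = nothing
valueAt c ((k , v) ∷ L) = if c ≡ᵇ k then just v else valueAt c L

entrySum : Entries → ℤ
entrySum = foldr (λ e s → proj₂ e ℤ.+ s) (+ 0)

≡ᵇ-true⇒≡ : ∀ {c k} → (c ≡ᵇ k) ≡ true → c ≡ k
≡ᵇ-true⇒≡ {c} {k} c≡ᵇk = ℕ.≡ᵇ⇒≡ c k (subst T (sym c≡ᵇk) _)

valueAt-here : ∀ {c k} v L → c ≡ k → valueAt c ((k , v) ∷ L) ≡ just v
valueAt-here {c} {k} v L c≡k with c ≡ᵇ k in c≡ᵇk
... | true  = refl
... | false = contradiction (subst T c≡ᵇk (ℕ.≡⇒≡ᵇ c k c≡k)) λ ()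

valueAt-there : ∀ {c k} v L → c ≢ k → valueAt c ((k , v) ∷ L) ≡ valueAt c L
valueAt-there {c} {k} v L c≢k with c ≡ᵇ k in c≡ᵇk
... | true  = contradiction (≡ᵇ-true⇒≡ c≡ᵇk) c≢k
... | false = refl

valueAt-absent : ∀ {c} L → All (c ≢_) (keys L) → valueAt c L ≡ nothing
valueAt-absent []            []          = refl
valueAt-absent ((k , v) ∷ L) (c≢k ∷ c∉L) = trans (valueAt-there v L c≢k) (valueAt-absent L c∉L)

valueAt-∈ : ∀ {k v} L → Unique (keys L) → (k , v) ∈ L → valueAt k L ≡ just v
valueAt-∈ ((k , v) ∷ L)   _                (here refl)  = valueAt-here v L refl
valueAt-∈ ((k′ , v′) ∷ L) (k′∉L ∷ unique) (there kv∈L) =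
  trans (valueAt-there v′ L (≢-sym (All.lookup k′∉L (∈-map⁺ proj₁ kv∈L)))) (valueAt-∈ L unique kv∈L)

module ∑-ValueAt (M : CommutativeMonoid 0ℓ 0ℓ) where
  open CommutativeMonoid M
    using (Carrier; _≈_; _∙_; ε; ∙-cong; ∙-congˡ; identityˡ; identityʳ)
    renaming (sym to ≈-sym; trans to ≈-trans)
  open import Algebra.Properties.CommutativeMonoid.Sum M public
  open import Relation.Binary.Reasoning.Setoid (CommutativeMonoid.setoid M)

  indicator : ℕ → ℕ → Carrier → Carrier
  indicator c k x = if c ≡ᵇ k then x else ε

  ∑-indicator : ∀ {n} k x → k < n → ∑[ i < n ] indicator (toℕ i) k x ≈ x
  ∑-indicator {suc n} zero x _ = begin
    x ∙ ∑[ i < n ] ε  ≈⟨ ∙-congˡ (sum-replicate-zero n) ⟩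
    x ∙ ε             ≈⟨ identityʳ x ⟩
    x                 ∎
  ∑-indicator {suc n} (suc k) x (s≤s k<n) = ≈-trans (identityˡ _) (∑-indicator k x k<n)

  module _ (w : Maybe ℤ → Carrier) (w-nothing : w nothing ≈ ε) where

    weight-cons : ∀ c k v L → All (k ≢_) (keys L) →
                  w (valueAt c ((k , v) ∷ L)) ≈ indicator c k (w (just v)) ∙ w (valueAt c L)
    weight-cons c k v L k∉L with c ≡ᵇ k in c≡ᵇk
    ... | false = ≈-sym (identityˡ _)
    ... | true with ≡ᵇ-true⇒≡ {c} {k} c≡ᵇk
    ...   | refl = begin
      w (just v)                    ≈⟨ identityʳ _ ⟨
      w (just v) ∙ ε                ≈⟨ ∙-congˡ w-nothing ⟨
      w (just v) ∙ w nothing        ≡⟨ cong (λ m → w (just v) ∙ w m) (valueAt-absent L k∉L) ⟨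
      w (just v) ∙ w (valueAt c L)  ∎

    ∑-valueAt : ∀ {n} L → Unique (keys L) → All (_< n) (keys L) →
                ∑[ i < n ] w (valueAt (toℕ i) L) ≈ foldr (λ e s → w (just (proj₂ e)) ∙ s) ε L
    ∑-valueAt {n} [] _ _ = ≈-trans (sum-cong-≋ {n} (λ _ → w-nothing)) (sum-replicate-zero n)
    ∑-valueAt {n} ((k , v) ∷ L) (k∉L ∷ unique) (k<n ∷ bounded) = begin
      ∑[ i < n ] w (valueAt (toℕ i) ((k , v) ∷ L))
        ≈⟨ sum-cong-≋ {n} (λ i → weight-cons (toℕ i) k v L k∉L) ⟩
      ∑[ i < n ] (indicator (toℕ i) k (w (just v)) ∙ w (valueAt (toℕ i) L))
        ≈⟨ ∑-distrib-+ {n} _ _ ⟩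
      ∑[ i < n ] indicator (toℕ i) k (w (just v)) ∙ ∑[ i < n ] w (valueAt (toℕ i) L)
        ≈⟨ ∙-cong (∑-indicator k (w (just v)) k<n) (∑-valueAt L unique bounded) ⟩
      w (just v) ∙ foldr (λ e s → w (just (proj₂ e)) ∙ s) ε L
        ∎

private
  module ℤ-∑ = ∑-ValueAt ℤ.+-0-commutativeMonoid
  module ℕ-∑ = ∑-ValueAt ℕ.+-0-commutativeMonoid

filled : Maybe ℤ → ℕ
filled (just _) = 1
filled nothing  = 0

lineSum≡∑ : ∀ {n} (f : Fin n → Maybe ℤ) → lineSum f ≡ ℤ-∑.sum (fromMaybe (+ 0) ∘ f)
lineSum≡∑ {zero}  f = refl
lineSum≡∑ {suc n} f with f zero
... | just v  = cong (ℤ._+_ v) (lineSum≡∑ (f ∘ suc))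
... | nothing = trans (lineSum≡∑ (f ∘ suc)) (sym (ℤ.+-identityˡ _))

filledCount≡∑ : ∀ {n} (f : Fin n → Maybe ℤ) → filledCount f ≡ ℕ-∑.sum (filled ∘ f)
filledCount≡∑ {zero}  f = refl
filledCount≡∑ {suc n} f with f zero
... | just _  = cong suc (filledCount≡∑ (f ∘ suc))
... | nothing = filledCount≡∑ (f ∘ suc)

module SparseLine {n} (F : Fin n → Maybe ℤ) (L : Entries) (F≗L : ∀ i → F i ≡ valueAt (toℕ i) L)
                  (unique : Unique (keys L)) (bounded : All (_< n) (keys L)) where

  lineSum≡entrySum : lineSum F ≡ entrySum L
  lineSum≡entrySum = trans (lineSum≡∑ F) (trans (ℤ-∑.sum-cong-≗ {n} (cong (fromMaybe (+ 0)) ∘ F≗L))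
                     (ℤ-∑.∑-valueAt (fromMaybe (+ 0)) refl L unique bounded))

  filledCount≡length : filledCount F ≡ length L
  filledCount≡length = trans (filledCount≡∑ F) (trans (ℕ-∑.sum-cong-≗ {n} (cong filled ∘ F≗L))
                         (ℕ-∑.∑-valueAt filled refl L unique bounded))

-- Rotation of {0, …, h - 1}

module Rotation (h : ℕ) where

  next : ℕ → ℕ
  next q with suc q ℕ.≟ h
  ... | yes _ = 0
  ... | no  _ = suc q

  prev : ℕ → ℕ
  prev zero    = pred h
  prev (suc p) = p

  next-< : ∀ {q} → q < h → next q < h
  next-< {q} q<h with suc q ℕ.≟ h
  ... | yes _     = ℕ.≤-<-trans z≤n q<h
  ... | no  1+q≢h = ℕ.≤∧≢⇒< q<h 1+q≢h

  prev-< : ∀ {p} → p < h → prev p < h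
  prev-< {zero}  0<h   = ℕ.≤-reflexive (ℕ.suc-pred h {{>-nonZero 0<h}})
  prev-< {suc p} 1+p<h = ℕ.<-trans (ℕ.n<1+n p) 1+p<h

  prev-next : ∀ {q} → q < h → prev (next q) ≡ q
  prev-next {q} q<h with suc q ℕ.≟ h
  ... | yes 1+q≡h = cong pred (sym 1+q≡h)
  ... | no  _     = refl

  next-prev : ∀ {p} → p < h → next (prev p) ≡ p
  next-prev {zero} 0<h with suc (pred h) ℕ.≟ h
  ... | yes _       = refl
  ... | no  1+h-1≢h = contradiction (ℕ.suc-pred h {{>-nonZero 0<h}}) 1+h-1≢h
  next-prev {suc p} 1+p<h with suc p ℕ.≟ h
  ... | yes 1+p≡h = contradiction 1+p≡h (ℕ.<⇒≢ 1+p<h)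
  ... | no  _     = refl

  rotate : ∀ {m} → Fin m → ℕ → ℕ
  rotate zero    q = q
  rotate (suc k) q = next (rotate k q)

  unrotate : ∀ {m} → Fin m → ℕ → ℕ
  unrotate zero    p = p
  unrotate (suc k) p = unrotate k (prev p)

  rotate-< : ∀ {m} (k : Fin m) {q} → q < h → rotate k q < h
  rotate-< zero    q<h = q<h
  rotate-< (suc k) q<h = next-< (rotate-< k q<h)

  unrotate-< : ∀ {m} (k : Fin m) {p} → p < h → unrotate k p < h
  unrotate-< zero    p<h = p<h
  unrotate-< (suc k) p<h = unrotate-< k (prev-< p<h)

  unrotate-rotate : ∀ {m} (k : Fin m) {q} → q < h → unrotate k (rotate k q) ≡ q
  unrotate-rotate zero    q<h = refl
  unrotate-rotate (suc k) q<h =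
    trans (cong (unrotate k) (prev-next (rotate-< k q<h))) (unrotate-rotate k q<h)

  rotate-unrotate : ∀ {m} (k : Fin m) {p} → p < h → rotate k (unrotate k p) ≡ p
  rotate-unrotate zero    p<h = refl
  rotate-unrotate (suc k) p<h =
    trans (cong next (rotate-unrotate k (prev-< p<h))) (next-prev p<h)

  module _ (3≤h : 3 ≤ h) where

    private
      h≢1 : h ≢ 1
      h≢1 h≡1 = contradiction (subst (3 ≤_) h≡1 3≤h) λ { (s≤s ()) }

      h≢2 : h ≢ 2
      h≢2 h≡2 = contradiction (subst (3 ≤_) h≡2 3≤h) λ { (s≤s (s≤s ())) }

    next-≢ : ∀ q → next q ≢ q
    next-≢ q with suc q ℕ.≟ h
    ... | yes 1+q≡h = λ { refl → h≢1 (sym 1+q≡h) }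
    ... | no  _     = ℕ.1+n≢n

    next²-≢ : ∀ q → next (next q) ≢ q
    next²-≢ q with suc q ℕ.≟ h
    next²-≢ q | yes 1+q≡h with 1 ℕ.≟ h
    ... | yes 1≡h = λ _ → h≢1 (sym 1≡h)
    ... | no  _   = λ { refl → h≢2 (sym 1+q≡h) }
    next²-≢ q | no _ with suc (suc q) ℕ.≟ h
    ... | yes 2+q≡h = λ { refl → h≢2 (sym 2+q≡h) }
    ... | no  _     = ≢-sym (ℕ.<⇒≢ (ℕ.m<n⇒m<1+n (ℕ.n<1+n q)))

    rotate-injective : ∀ {q} (k j : Fin 3) → rotate k q ≡ rotate j q → k ≡ j
    rotate-injective     0F 0F _ = refl
    rotate-injective     1F 1F _ = refl
    rotate-injective     2F 2F _ = refl
    rotate-injective {q} 0F 1F e = contradiction (sym e) (next-≢ q)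
    rotate-injective {q} 1F 0F e = contradiction e (next-≢ q)
    rotate-injective {q} 0F 2F e = contradiction (sym e) (next²-≢ q)
    rotate-injective {q} 2F 0F e = contradiction e (next²-≢ q)
    rotate-injective {q} 1F 2F e = contradiction (sym e) (next-≢ (next q))
    rotate-injective {q} 2F 1F e = contradiction e (next-≢ (next q))

-- Arrays assembled from permutation diagonals

xor-cancelʳ : ∀ b f → (b xor f) xor f ≡ b
xor-cancelʳ b f = trans (xor-assoc b f f) (trans (cong (b xor_) (xor-same f)) (xor-identityʳ b))

xor-injectiveˡ : ∀ b {f g} → b xor f ≡ b xor g → f ≡ g
xor-injectiveˡ false e = e
xor-injectiveˡ true  e = not-injective e

module Diagonals (h : ℕ) where
  open Rotation h

  -- (b , q) is the q-th row or column of the first (b = false) or second (b = true) half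
  Position : Set
  Position = Bool × ℕ

  InRange : Position → Set
  InRange (_ , q) = q < h

  pos : Position → ℕ
  pos (false , q) = q
  pos (true  , q) = h + q

  pos-< : ∀ x → InRange x → pos x < h + h
  pos-< (false , q) q<h = ℕ.<-≤-trans q<h (ℕ.m≤m+n h h)
  pos-< (true  , q) q<h = ℕ.+-monoʳ-< h q<h

  private
    low≢high : ∀ {q p} → q < h → q ≢ h + p
    low≢high q<h q≡h+p = ℕ.<⇒≱ q<h (subst (h ≤_) (sym q≡h+p) (ℕ.m≤m+n _ _))

  pos-injective : ∀ x y → InRange x → InRange y → pos x ≡ pos y → x ≡ y
  pos-injective (false , q) (false , p) _   _   q≡p = cong (false ,_) q≡p
  pos-injective (true  , q) (true  , p) _   _   e   = cong (true ,_) (ℕ.+-cancelˡ-≡ h q p e)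
  pos-injective (false , q) (true  , p) q<h _   e   = contradiction e (low≢high q<h)
  pos-injective (true  , q) (false , p) _   p<h e   = contradiction (sym e) (low≢high p<h)

  split : ℕ → Position
  split r with r <? h
  ... | yes _ = false , r
  ... | no  _ = true , r ∸ h

  split-InRange : ∀ {r} → r < h + h → InRange (split r)
  split-InRange {r} r<2h with r <? h
  ... | yes r<h = r<h
  ... | no  r≮h = subst (r ∸ h <_) (ℕ.m+n∸m≡n h h) (ℕ.∸-monoˡ-< r<2h (ℕ.≮⇒≥ r≮h))

  pos-split : ∀ r → pos (split r) ≡ r
  pos-split r with r <? h
  ... | yes _   = refl
  ... | no  r≮h = ℕ.m+[n∸m]≡n (ℕ.≮⇒≥ r≮h)

  split-pos : ∀ x → InRange x → split (pos x) ≡ x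
  split-pos x x∈ = pos-injective _ x (split-InRange (pos-< x x∈)) x∈ (pos-split (pos x))

  Shape : Set
  Shape = Bool × Fin 3

  target : Shape → Position → Position
  target (f , k) (b , q) = b xor f , rotate k q

  source : Shape → Position → Position
  source (f , k) (b , p) = b xor f , unrotate k p

  target-InRange : ∀ s x → InRange x → InRange (target s x)
  target-InRange (_ , k) _ q<h = rotate-< k q<h

  source-InRange : ∀ s y → InRange y → InRange (source s y)
  source-InRange (_ , k) _ p<h = unrotate-< k p<h

  source-target : ∀ s x → InRange x → source s (target s x) ≡ x
  source-target (f , k) (b , q) q<h = cong₂ _,_ (xor-cancelʳ b f) (unrotate-rotate k q<h)

  target-source : ∀ s y → InRange y → target s (source s y) ≡ y
  target-source (f , k) (b , p) p<h = cong₂ _,_ (xor-cancelʳ b f) (rotate-unrotate k p<h)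

  module _ (3≤h : 3 ≤ h) where

    target-injective : ∀ {s t} x → target s x ≡ target t x → s ≡ t
    target-injective {f , k} {g , j} (b , q) e =
      cong₂ _,_ (xor-injectiveˡ b (cong proj₁ e)) (rotate-injective 3≤h k j (cong proj₂ e))

    source-injective : ∀ {s t} y → InRange y → source s y ≡ source t y → s ≡ t
    source-injective {s} {t} y y∈ e = target-injective (source s y)
      (trans (target-source s y y∈) (sym (trans (cong (target t) e) (target-source t y y∈))))

  _≟ₚ_ : (x y : Position) → Dec (x ≡ y)
  _≟ₚ_ = ≡-dec Bool._≟_ ℕ._≟_

  -- v x p is the entry of a diagonal in row x, whose column has index p within its half
  Value : Set
  Value = Position → ℕ → ℤ

  Diagonal : Set
  Diagonal = Shape × Value

  rowEntry : Position → Diagonal → ℕ × ℤ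
  rowEntry x (s , v) = pos (target s x) , v x (proj₂ (target s x))

  colEntry : Position → Diagonal → ℕ × ℤ
  colEntry y (s , v) = pos (source s y) , v (source s y) (proj₂ y)

  rowEntries : List Diagonal → Position → Entries
  rowEntries ds x = map (rowEntry x) ds

  colEntries : List Diagonal → Position → Entries
  colEntries ds y = map (colEntry y) ds

  -- Both lookups stop at the same diagonal: the first one through the cell (x , y).
  valueAt-row≡col : ∀ ds x y → InRange x → InRange y →
                    valueAt (pos y) (rowEntries ds x) ≡ valueAt (pos x) (colEntries ds y)
  valueAt-row≡col []             _ _ _  _  = refl
  valueAt-row≡col ((s , v) ∷ ds) x y x∈ y∈ with y ≟ₚ target s x
  ... | yes refl = trans (valueAt-here _ (rowEntries ds x) refl) (sym (trans
        (valueAt-here _ (colEntries ds y) (cong pos x≡sy))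
        (cong (λ z → just (v z (proj₂ y))) (sym x≡sy))))
    where x≡sy = sym (source-target s x x∈)
  ... | no  y≢tx = trans (valueAt-there _ (rowEntries ds x) pos-y≢tx)
        (trans (valueAt-row≡col ds x y x∈ y∈) (sym (valueAt-there _ (colEntries ds y) pos-x≢sy)))
    where
    pos-y≢tx : pos y ≢ pos (target s x)
    pos-y≢tx = y≢tx ∘ pos-injective y (target s x) y∈ (target-InRange s x x∈)

    pos-x≢sy : pos x ≢ pos (source s y)
    pos-x≢sy = λ e → y≢tx (trans (sym (target-source s y y∈))
      (cong (target s) (sym (pos-injective x (source s y) x∈ (source-InRange s y y∈) e))))

  rowEntries-bounded : ∀ ds x → InRange x → All (_< h + h) (keys (rowEntries ds x))
  rowEntries-bounded ds x x∈ =
    All.map⁺ (All.map⁺ (universal (λ (s , _) → pos-< (target s x) (target-InRange s x x∈)) ds))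

  colEntries-bounded : ∀ ds y → InRange y → All (_< h + h) (keys (colEntries ds y))
  colEntries-bounded ds y y∈ =
    All.map⁺ (All.map⁺ (universal (λ (s , _) → pos-< (source s y) (source-InRange s y y∈)) ds))

  module _ (3≤h : 3 ≤ h) (ds : List Diagonal) (shapes-unique : Unique (map proj₁ ds)) where

    rowEntries-unique : ∀ x → InRange x → Unique (keys (rowEntries ds x))
    rowEntries-unique x x∈ = subst Unique (trans (sym (map-∘ _)) (map-∘ ds)) (Unique.map⁺
      (λ {s} {t} e → target-injective 3≤h x
        (pos-injective (target s x) (target t x) (target-InRange s x x∈) (target-InRange t x x∈) e))
      shapes-unique)

    colEntries-unique : ∀ y → InRange y → Unique (keys (colEntries ds y))
    colEntries-unique y y∈ = subst Unique (trans (sym (map-∘ _)) (map-∘ ds)) (Unique.map⁺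
      (λ {s} {t} e → source-injective 3≤h y y∈
        (pos-injective (source s y) (source t y) (source-InRange s y y∈) (source-InRange t y y∈) e))
      shapes-unique)

    valueAt-target : ∀ {s v} x → InRange x → (s , v) ∈ ds →
                     valueAt (pos (target s x)) (rowEntries ds x) ≡ just (v x (proj₂ (target s x)))
    valueAt-target x x∈ d∈ = valueAt-∈ _ (rowEntries-unique x x∈) (∈-map⁺ (rowEntry x) d∈)

    valueAt-source : ∀ {s v} y → InRange y → (s , v) ∈ ds →
                     valueAt (pos (source s y)) (colEntries ds y) ≡ just (v (source s y) (proj₂ y))
    valueAt-source y y∈ d∈ = valueAt-∈ _ (colEntries-unique y y∈) (∈-map⁺ (colEntry y) d∈)

-- The absolute values of the entries, band by band

band-form : ∀ r t h → + suc (r + t * h) ≡ + 1 ℤ.+ (+ r ℤ.+ + t ℤ.* + h)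
band-form r t h = cong (λ z → + 1 ℤ.+ (+ r ℤ.+ z)) (ℤ.pos-* t h)

band-direct : ∀ r t h → + suc (r + t * h) ≡ + t ℤ.* + h ℤ.+ + 1 ℤ.+ + r
band-direct r t h = trans (band-form r t h) (identity (+ r) (+ t) (+ h))
  where
  identity : ∀ R T H → + 1 ℤ.+ (R ℤ.+ T ℤ.* H) ≡ T ℤ.* H ℤ.+ + 1 ℤ.+ R
  identity = solve-∀

band-mirror : ∀ {h} r t q → suc (r + q) ≡ h → + suc (r + t * h) ≡ + suc t ℤ.* + h ℤ.- + q
band-mirror r t q refl = trans (band-form r t _) (identity (+ r) (+ t) (+ q))
  where
  identity : ∀ R T Q →
             + 1 ℤ.+ (R ℤ.+ T ℤ.* (+ 1 ℤ.+ (R ℤ.+ Q))) ≡ (+ 1 ℤ.+ T) ℤ.* (+ 1 ℤ.+ (R ℤ.+ Q)) ℤ.- Q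
  identity = solve-∀

middle-even : ∀ w h → + suc ((w + w) + 1 * h) ≡ + h ℤ.+ + 1 ℤ.+ + 2 ℤ.* + w
middle-even w h = trans (band-form (w + w) 1 h) (identity (+ w) (+ h))
  where
  identity : ∀ W H → + 1 ℤ.+ ((W ℤ.+ W) ℤ.+ + 1 ℤ.* H) ≡ H ℤ.+ + 1 ℤ.+ + 2 ℤ.* W
  identity = solve-∀

middle-odd : ∀ {h} w q → suc (w + q) ≡ h → + suc (suc (w + w) + 1 * h) ≡ + 3 ℤ.* + h ℤ.- + 2 ℤ.* + q
middle-odd w q refl = trans (band-form (suc (w + w)) 1 _) (identity (+ w) (+ q))
  where
  identity : ∀ W Q → + 1 ℤ.+ ((+ 1 ℤ.+ (W ℤ.+ W)) ℤ.+ + 1 ℤ.* (+ 1 ℤ.+ (W ℤ.+ Q)))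
                     ≡ + 3 ℤ.* (+ 1 ℤ.+ (W ℤ.+ Q)) ℤ.- + 2 ℤ.* Q
  identity = solve-∀

even-or-odd : ∀ u → ∃ λ w → u ≡ w + w ⊎ u ≡ suc (w + w)
even-or-odd zero       = 0 , inj₁ refl
even-or-odd (suc zero) = 0 , inj₂ refl
even-or-odd (suc (suc u)) with even-or-odd u
... | w , inj₁ refl = suc w , inj₁ (cong suc (sym (ℕ.+-suc w w)))
... | w , inj₂ refl = suc w , inj₂ (cong (_+_ 2) (sym (ℕ.+-suc w w)))

-- The array for n = h + h

module HeffterArray (h : ℕ) (3≤h : 3 ≤ h) where
  open Rotation h
  open Diagonals h

  stay₀ stay₁ stay₂ cross₁ cross₂ : Value
  stay₀  (false , q) _ = + h ℤ.+ + 1 ℤ.+ + 2 ℤ.* + q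
  stay₀  (true  , q) _ = + 3 ℤ.* + h ℤ.- + 2 ℤ.* + q
  stay₁  (false , q) _ = + 6 ℤ.* + h ℤ.- + q
  stay₁  (true  , q) _ = - (+ h ℤ.- + q)
  stay₂  (false , _) p = + 8 ℤ.* + h ℤ.- + p
  stay₂  (true  , _) p = - (+ 7 ℤ.* + h ℤ.- + p)
  cross₁ (false , q) _ = + 9 ℤ.* + h ℤ.- + q
  cross₁ (true  , q) _ = + 9 ℤ.* + h ℤ.+ + 1 ℤ.+ + q
  cross₂ (false , _) p = - (+ 4 ℤ.* + h ℤ.- + p)
  cross₂ (true  , _) p = - (+ 4 ℤ.* + h ℤ.+ + 1 ℤ.+ + p)

  diagonals : List Diagonal
  diagonals = ((false , 0F) , stay₀) ∷ ((false , 1F) , stay₁) ∷ ((false , 2F) , stay₂)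
            ∷ ((true , 1F) , cross₁) ∷ ((true , 2F) , cross₂) ∷ []

  stay₀∈ : ((false , 0F) , stay₀) ∈ diagonals
  stay₀∈ = here refl

  stay₁∈ : ((false , 1F) , stay₁) ∈ diagonals
  stay₁∈ = there (here refl)

  stay₂∈ : ((false , 2F) , stay₂) ∈ diagonals
  stay₂∈ = there (there (here refl))

  cross₁∈ : ((true , 1F) , cross₁) ∈ diagonals
  cross₁∈ = there (there (there (here refl)))

  cross₂∈ : ((true , 2F) , cross₂) ∈ diagonals
  cross₂∈ = there (there (there (there (here refl))))

  shapes-unique : Unique (map proj₁ diagonals)
  shapes-unique = from-yes (unique? (map proj₁ diagonals))
    where open import Data.List.Relation.Unary.Unique.DecPropositional (≡-dec Bool._≟_ (Fin._≟_ {3}))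

  M : ℕ
  M = 2 * (h + h) * 5 + 1

  20h+1≡M : + 20 ℤ.* + h ℤ.+ + 1 ≡ + M
  20h+1≡M = trans (cong (ℤ._+ + 1) (sym (ℤ.pos-* 20 h))) (cong (λ m → + (m + 1)) (identity h))
    where
    identity : ∀ h → 20 * h ≡ 2 * (h + h) * 5
    identity = ℕ.solve-∀

  top-row-total : ∀ q → entrySum (rowEntries diagonals (false , q)) ≡ + M
  top-row-total q = trans (identity (+ h) (+ q) (+ next (next q))) 20h+1≡M
    where
    identity : ∀ H Q P → (H ℤ.+ + 1 ℤ.+ + 2 ℤ.* Q) ℤ.+ ((+ 6 ℤ.* H ℤ.- Q) ℤ.+ ((+ 8 ℤ.* H ℤ.- P) ℤ.+
                         ((+ 9 ℤ.* H ℤ.- Q) ℤ.+ (- (+ 4 ℤ.* H ℤ.- P) ℤ.+ + 0))))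
                       ≡ + 20 ℤ.* H ℤ.+ + 1
    identity = solve-∀

  bottom-row-total : ∀ q → entrySum (rowEntries diagonals (true , q)) ≡ + 0
  bottom-row-total q = identity (+ h) (+ q) (+ next (next q))
    where
    identity : ∀ H Q P → (+ 3 ℤ.* H ℤ.- + 2 ℤ.* Q) ℤ.+ (- (H ℤ.- Q) ℤ.+ (- (+ 7 ℤ.* H ℤ.- P) ℤ.+
                         ((+ 9 ℤ.* H ℤ.+ + 1 ℤ.+ Q) ℤ.+ (- (+ 4 ℤ.* H ℤ.+ + 1 ℤ.+ P) ℤ.+ + 0))))
                       ≡ + 0
    identity = solve-∀

  top-col-total : ∀ p → entrySum (colEntries diagonals (false , p)) ≡ + M
  top-col-total p = trans (identity (+ h) (+ p) (+ prev p)) 20h+1≡M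
    where
    identity : ∀ H P Q → (H ℤ.+ + 1 ℤ.+ + 2 ℤ.* P) ℤ.+ ((+ 6 ℤ.* H ℤ.- Q) ℤ.+ ((+ 8 ℤ.* H ℤ.- P) ℤ.+
                         ((+ 9 ℤ.* H ℤ.+ + 1 ℤ.+ Q) ℤ.+ (- (+ 4 ℤ.* H ℤ.+ + 1 ℤ.+ P) ℤ.+ + 0))))
                       ≡ + 20 ℤ.* H ℤ.+ + 1
    identity = solve-∀

  bottom-col-total : ∀ p → entrySum (colEntries diagonals (true , p)) ≡ + 0
  bottom-col-total p = identity (+ h) (+ p) (+ prev p)
    where
    identity : ∀ H P Q → (+ 3 ℤ.* H ℤ.- + 2 ℤ.* P) ℤ.+ (- (H ℤ.- Q) ℤ.+ (- (+ 7 ℤ.* H ℤ.- P) ℤ.+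
                         ((+ 9 ℤ.* H ℤ.- Q) ℤ.+ (- (+ 4 ℤ.* H ℤ.- P) ℤ.+ + 0))))
                       ≡ + 0
    identity = solve-∀

  row-total : ∀ x → entrySum (rowEntries diagonals x) ≡ + M ⊎ entrySum (rowEntries diagonals x) ≡ + 0
  row-total (false , q) = inj₁ (top-row-total q)
  row-total (true  , q) = inj₂ (bottom-row-total q)

  col-total : ∀ y → entrySum (colEntries diagonals y) ≡ + M ⊎ entrySum (colEntries diagonals y) ≡ + 0
  col-total (false , p) = inj₁ (top-col-total p)
  col-total (true  , p) = inj₂ (bottom-col-total p)

  M∣ : ∀ {z} → z ≡ + M ⊎ z ≡ + 0 → + M ∣ z
  M∣ (inj₁ refl) = ℕ.∣-refl
  M∣ (inj₂ refl) = M ℕ.∣0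

  cell : ℕ → ℕ → Maybe ℤ
  cell r c = valueAt c (rowEntries diagonals (split r))

  array : PartialArray (h + h)
  array i j = cell (toℕ i) (toℕ j)

  cell-pos : ∀ x c → InRange x → cell (pos x) c ≡ valueAt c (rowEntries diagonals x)
  cell-pos x c x∈ = cong (λ x′ → valueAt c (rowEntries diagonals x′)) (split-pos x x∈)

  cell-column : ∀ r c → r < h + h → c < h + h → cell r c ≡ valueAt r (colEntries diagonals (split c))
  cell-column r c r<2h c<2h = begin
    valueAt c (rowEntries diagonals (split r))
      ≡⟨ cong (λ c → valueAt c (rowEntries diagonals (split r))) (pos-split c) ⟨
    valueAt (pos (split c)) (rowEntries diagonals (split r))
      ≡⟨ valueAt-row≡col diagonals (split r) (split c) (split-InRange r<2h) (split-InRange c<2h) ⟩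
    valueAt (pos (split r)) (colEntries diagonals (split c))
      ≡⟨ cong (λ r → valueAt r (colEntries diagonals (split c))) (pos-split r) ⟩
    valueAt r (colEntries diagonals (split c))
      ∎
    where open ≡-Reasoning

  module RowLine (i : Fin (h + h)) = SparseLine (row array i)
    (rowEntries diagonals (split (toℕ i))) (λ _ → refl)
    (rowEntries-unique 3≤h diagonals shapes-unique (split (toℕ i)) (split-InRange (toℕ<n i)))
    (rowEntries-bounded diagonals (split (toℕ i)) (split-InRange (toℕ<n i)))

  module ColLine (j : Fin (h + h)) = SparseLine (col array j)
    (colEntries diagonals (split (toℕ j))) (λ i → cell-column (toℕ i) (toℕ j) (toℕ<n i) (toℕ<n j))
    (colEntries-unique 3≤h diagonals shapes-unique (split (toℕ j)) (split-InRange (toℕ<n j)))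
    (colEntries-bounded diagonals (split (toℕ j)) (split-InRange (toℕ<n j)))

  _≡±_ : Maybe ℤ → ℤ → Set
  m ≡± z = m ≡ just z ⊎ m ≡ just (- z)

  Covered : ℤ → Set
  Covered z = Σ (Fin (h + h)) λ i → Σ (Fin (h + h)) λ j → array i j ≡± z

  covered-by-cell : ∀ {z} x y → InRange x → InRange y → cell (pos x) (pos y) ≡± z → Covered z
  covered-by-cell {z} x y x∈ y∈ e = fromℕ< (pos-< x x∈) , fromℕ< (pos-< y y∈) ,
    subst (_≡± z) (sym (cong₂ cell (toℕ-fromℕ< (pos-< x x∈)) (toℕ-fromℕ< (pos-< y y∈)))) e

  just-≡± : ∀ {m a z} → m ≡ just a → a ≡ z ⊎ a ≡ - z → m ≡± z
  just-≡± m≡a = Sum.map (trans m≡a ∘ cong just) (trans m≡a ∘ cong just)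

  covered-by-row : ∀ {s v z} x → InRange x → (s , v) ∈ diagonals →
                   v x (proj₂ (target s x)) ≡ z ⊎ v x (proj₂ (target s x)) ≡ - z → Covered z
  covered-by-row {s} x x∈ d∈ = covered-by-cell x (target s x) x∈ (target-InRange s x x∈) ∘ just-≡±
    (trans (cell-pos x (pos (target s x)) x∈) (valueAt-target 3≤h diagonals shapes-unique x x∈ d∈))

  covered-by-col : ∀ {s v z} y → InRange y → (s , v) ∈ diagonals →
                   v (source s y) (proj₂ y) ≡ z ⊎ v (source s y) (proj₂ y) ≡ - z → Covered z
  covered-by-col {s} {v} y y∈ d∈ = covered-by-cell (source s y) y sy∈ y∈ ∘ just-≡± (begin
    cell (pos (source s y)) (pos y)
      ≡⟨ cell-column _ _ (pos-< (source s y) sy∈) (pos-< y y∈) ⟩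
    valueAt (pos (source s y)) (colEntries diagonals (split (pos y)))
      ≡⟨ cong (λ y′ → valueAt (pos (source s y)) (colEntries diagonals y′)) (split-pos y y∈) ⟩
    valueAt (pos (source s y)) (colEntries diagonals y)
      ≡⟨ valueAt-source 3≤h diagonals shapes-unique y y∈ d∈ ⟩
    just (v (source s y) (proj₂ y))
      ∎)
    where open ≡-Reasoning
          sy∈ = source-InRange s y y∈

  mirror : ∀ {r} → r < h → ∃ λ q → q < h × suc (r + q) ≡ h
  mirror {r} r<h with ℕ.m≤n⇒∃[o]m+o≡n r<h
  ... | q , 1+r+q≡h = q , subst (q <_) 1+r+q≡h (s≤s (ℕ.m≤n+m q r)) , 1+r+q≡h

  half-< : ∀ {w} → w + w < h + h → w < h
  half-< w+w<2h = ℕ.≰⇒> λ h≤w → ℕ.<⇒≱ w+w<2h (ℕ.+-mono-≤ h≤w h≤w)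

  covered-middle : ∀ u → u < h + h → Covered (+ suc (u + 1 * h))
  covered-middle u u<2h with even-or-odd u
  ... | w , inj₁ refl = covered-by-row (false , w) (half-< u<2h) stay₀∈ (inj₁ (sym (middle-even w h)))
  ... | w , inj₂ refl with mirror (half-< (ℕ.<-trans (ℕ.n<1+n (w + w)) u<2h))
  ...   | q , q<h , 1+w+q≡h = covered-by-row (true , q) q<h stay₀∈ (inj₁ (sym (middle-odd w q 1+w+q≡h)))

  -- An entry (t + 1)h − q lies in band t at offset r = h − 1 − q, an entry th + 1 + q at offset q.
  covered-band : ∀ r (t : Fin 10) → r < h → Covered (+ suc (r + toℕ t * h))
  covered-band r 0F r<h with mirror r<h
  ... | q , q<h , e = covered-by-row (true , q) q<h stay₁∈
        (inj₂ (cong -_ (sym (trans (band-mirror r 0 q e) (cong (ℤ._- + q) (ℤ.*-identityˡ (+ h)))))))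
  covered-band r 1F r<h = covered-middle r (ℕ.<-≤-trans r<h (ℕ.m≤m+n h h))
  covered-band r 2F r<h =
    subst (Covered ∘ +_ ∘ suc) (identity r h) (covered-middle (h + r) (ℕ.+-monoʳ-< h r<h))
    where identity : ∀ r h → (h + r) + 1 * h ≡ r + 2 * h
          identity = ℕ.solve-∀
  covered-band r 3F r<h with mirror r<h
  ... | p , p<h , e = covered-by-col (true , p) p<h cross₂∈ (inj₂ (cong -_ (sym (band-mirror r 3 p e))))
  covered-band r 4F r<h =
    covered-by-col (false , r) r<h cross₂∈ (inj₂ (cong -_ (sym (band-direct r 4 h))))
  covered-band r 5F r<h with mirror r<h
  ... | q , q<h , e = covered-by-row (false , q) q<h stay₁∈ (inj₁ (sym (band-mirror r 5 q e)))
  covered-band r 6F r<h with mirror r<h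
  ... | p , p<h , e = covered-by-col (true , p) p<h stay₂∈ (inj₂ (cong -_ (sym (band-mirror r 6 p e))))
  covered-band r 7F r<h with mirror r<h
  ... | p , p<h , e = covered-by-col (false , p) p<h stay₂∈ (inj₁ (sym (band-mirror r 7 p e)))
  covered-band r 8F r<h with mirror r<h
  ... | q , q<h , e = covered-by-row (false , q) q<h cross₁∈ (inj₁ (sym (band-mirror r 8 q e)))
  covered-band r 9F r<h = covered-by-row (true , r) r<h cross₁∈ (inj₁ (sym (band-direct r 9 h)))

  covered : ∀ x → 1 ≤ x → x ≤ (h + h) * 5 → Covered (+ x)
  covered (suc y) _ y<10h =
    subst (Covered ∘ +_ ∘ suc) y≡r+th (covered-band (y % h) (fromℕ< t<10) (ℕ.m%n<n y h))
    where
    instance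
      h-nonZero : ℕ.NonZero h
      h-nonZero = >-nonZero (ℕ.≤-trans (s≤s z≤n) 3≤h)

    t<10 : y / h < 10
    t<10 = ℕ.m<n*o⇒m/o<n (subst (y <_) (identity h) y<10h)
      where identity : ∀ h → (h + h) * 5 ≡ 10 * h
            identity = ℕ.solve-∀

    y≡r+th : y % h + toℕ (fromℕ< t<10) * h ≡ y
    y≡r+th = trans (cong (λ t → y % h + t * h) (toℕ-fromℕ< t<10)) (sym (ℕ.m≡m%n+[m/n]*n y h))

  isHeffter : IsHeffter (h + h) 5 array
  isHeffter = record
    { rowFilled = RowLine.filledCount≡length
    ; colFilled = ColLine.filledCount≡length
    ; rowSum    = λ i → subst (+ M ∣_) (sym (RowLine.lineSum≡entrySum i))
                                (M∣ (row-total (split (toℕ i))))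
    ; colSum    = λ j → subst (+ M ∣_) (sym (ColLine.lineSum≡entrySum j))
                                (M∣ (col-total (split (toℕ j))))
    ; covers    = covered
    }

heffterArray-h+h : ∀ h → 3 ≤ h → HeffterArrayExists (h + h) 5
heffterArray-h+h h 3≤h = HeffterArray.array h 3≤h , HeffterArray.isHeffter h 3≤h

n%4≡2⇒n≡h+h : ∀ n → 6 ≤ n → n % 4 ≡ 2 → ∃ λ h → 3 ≤ h × n ≡ h + h
n%4≡2⇒n≡h+h n 6≤n n%4≡2 with n / 4 | ℕ.m≡m%n+[m/n]*n n 4
... | zero  | n≡n%4+0 = contradiction (subst (6 ≤_) (trans n≡n%4+0 (cong (_+ 0) n%4≡2)) 6≤n)
                          λ { (s≤s (s≤s ())) }
... | suc k | n≡n%4+4k+4 = 3 + k * 2 , s≤s (s≤s (s≤s z≤n)) ,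
                           trans n≡n%4+4k+4 (trans (cong (_+ suc k * 4) n%4≡2) (identity k))
  where identity : ∀ k → 2 + suc k * 4 ≡ (3 + k * 2) + (3 + k * 2)
        identity = ℕ.solve-∀

lemma7p1 : (n : ℕ) → 6 ≤ n → n % 4 ≡ 2 → HeffterArrayExists n 5
lemma7p1 n 6≤n n%4≡2 with n%4≡2⇒n≡h+h n 6≤n n%4≡2
... | h , 3≤h , refl = heffterArray-h+h h 3≤h
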